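{- Let $(X,\mathcal{B})$ be an $\mathsf{SQS}(v)$ used as a distribution design for a combinatorial repairable threshold scheme, and let $B\in\mathcal{B}$ be the block of a player. Suppose every other player is available independently with probability $p$, and let $q=1-p$. Then the probability that there is at least one available repair set for $B$ is \[\mathcal{R}(p)=1-4q^{r_1-1}+6q^{2r_1-r_2-1}-4q^{3r_1-3r_2}+q^{4r_1-6r_2+2},\] where $r_1=\binom{v-1}{2}/3$ and $r_2=\binom{v-2}{1}/2$.
   Context: An $\mathsf{SQS}(v)$ is a $3$-$(v,4,1)$-design: a set system $(X,\mathcal{B})$ with $|X|=v$, all blocks of size $4$, every $3$-set of points in exactly one block; $r_1$ (resp. $r_2$) is the number of blocks containing any given point (resp. any given pair of points). Blocks correspond to players. A repair set for the player with block $B$ is a set of other blocks (players) whose union contains $B$; it is available if all its players are available. $\mathcal{R}(p)$ is the probability that at least one available repair set exists.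
   Formalization: The availability probability p of each other player ranges only over the rationals between 0 and 1. -}

module Defs where

open import Data.Bool using (Bool; true; false; if_then_else_)
open import Data.Nat as ℕ using (ℕ; zero; suc; _∸_)
open import Data.Nat.Combinatorics using (_C_)
open import Data.Fin using (Fin; _≟_)
open import Data.Fin.Subset using (Subset; _⊆_; _∉_; ⋃; ∣_∣; outside; inside)
open import Data.Fin.Subset.Properties using (_⊆?_; _∈?_)
open import Data.List using (List; []; _∷_; map; filter; length; foldr; _++_; allFin)
open import Data.Bool.ListAction using (any)

open import Data.Vec using (Vec; []; _∷_)
open import Data.Product using (_×_)
open import Data.Rational using (ℚ; 0ℚ; 1ℚ; _+_; _*_)
open import Relation.Nullary using (¬_; does)
open import Relation.Nullary.Decidable using (¬?; _×-dec_)
open import Relation.Binary.PropositionalEquality using (_≡_)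

allSubsets : (n : ℕ) → List (Subset n)
allSubsets zero = [] ∷ []
allSubsets (suc n) = map (outside ∷_) (allSubsets n) ++ map (inside ∷_) (allSubsets n)

-- Players are indexed by Fin b; player j holds block 𝓑 j ⊆ X = Fin v.
-- Elements of a player set S (as a list).
members : {b : ℕ} → Subset b → List (Fin b)
members {b} S = filter (_∈? S) (allFin b)

unionOf : {v b : ℕ} → (Fin b → Subset v) → Subset b → Subset v
unionOf 𝓑 S = ⋃ (map 𝓑 (members S))

record IsSQS (v b : ℕ) (𝓑 : Fin b → Subset v) : Set where
  field
    blockSize : (j : Fin b) → ∣ 𝓑 j ∣ ≡ 4
    threeSets : (T : Subset v) → ∣ T ∣ ≡ 3 →
                length (filter (λ j → T ⊆? 𝓑 j) (allFin b)) ≡ 1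

IsRepairSet : {v b : ℕ} → (Fin b → Subset v) → Fin b → Subset b → Set
IsRepairSet 𝓑 i S = (i ∉ S) × (𝓑 i ⊆ unionOf 𝓑 S)

availableRepairExists : {v b : ℕ} → (Fin b → Subset v) → Fin b → Subset b → Bool
availableRepairExists 𝓑 i A =
  any (λ S → does ((S ⊆? A) ×-dec ((¬? (i ∈? S)) ×-dec (𝓑 i ⊆? unionOf 𝓑 S))))
      (allSubsets _)

sumℚ : List ℚ → ℚ
sumℚ = foldr _+_ 0ℚ

prodℚ : List ℚ → ℚ
prodℚ = foldr _*_ 1ℚ

_^_ : ℚ → ℕ → ℚ
x ^ zero = 1ℚ
x ^ suc n = x * (x ^ n)

configWeight : {b : ℕ} → ℚ → ℚ → Fin b → Subset b → ℚ
configWeight {b} p q i A =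
  prodℚ (map (λ j → if does (j ≟ i) then 1ℚ
                    else (if does (j ∈? A) then p else q)) (allFin b))

repairProb : {v b : ℕ} → (Fin b → Subset v) → Fin b → ℚ → ℚ → ℚ
repairProb {v} {b} 𝓑 i p q =
  sumℚ (map (λ A → if does (i ∈? A) then 0ℚ
                   else (if availableRepairExists 𝓑 i A then configWeight p q i A else 0ℚ))
            (allSubsets b))

r₁ : ℕ → ℕ
r₁ v = ((v ∸ 1) C 2) ℕ./ 3

r₂ : ℕ → ℕ
r₂ v = ((v ∸ 2) C 1) ℕ./ 2

module Submission where

-- Number the four points of the block B = 𝓑 i of player i as 0, …, 3 and call
-- {k | point k ∈ 𝓑 j} the trace of block j on B.  The proof has four independent parts.
--  * RepairEvent: an available repair set exists iff the traces of all available players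
--    cover {0, …, 3} (a repair set inside the available players can be enlarged to all of them).
--  * Coverage: for independently available players, inclusion–exclusion over the uncovered
--    points gives  P(cover) = Σ_{T ⊆ {0..3}} (−1)^|T| · Π_{j : trace j meets T} (1 − p_j).
--  * Designs, SecondOrder, BlockTraces: by double counting, in an SQS(v) every point lies in r₁
--    blocks, every pair in r₂ and every triple in exactly one.  Hence the traces of the blocks
--    j ≠ i contain each point r₁ − 1 times, each pair r₂ − 1 times and no three points, so
--    second-order inclusion–exclusion is exact: T is met by s(r₁ − 1) − C(s,2)(r₂ − 1) of
--    them, where s = |T|.
--  * SubsetSums: grouped by size, Σ_T (−1)^|T| f(|T|) over the subsets of a 4-set is the fourth
--    difference f 0 − 4 f 1 + 6 f 2 − 4 f 3 + f 4.  With f(s) = q^(s(r₁−1) − C(s,2)(r₂−1)) and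
--    the exponents rewritten in r₁ and r₂ (Exponents) this is the stated formula.

open import Data.Bool using (Bool; true; false; T; not; _∧_; _∨_; if_then_else_)
open import Data.Nat using (ℕ; zero; suc)
open import Data.Fin using (Fin; zero; suc; _≟_)
open import Data.Fin.Subset using (Subset; _∈_)
open import Function using (_∘_)
open import Relation.Nullary using (Dec; does; yes; no; ¬_)
open import Relation.Binary.PropositionalEquality
open import Defs using (IsSQS)

module Counting where

  open import Data.Nat using (_+_; _*_)
  open import Data.Nat.Properties using (+-*-semiring; +-identityʳ; +-comm; +-assoc; m+n≡0⇒m≡0; m+n≡0⇒n≡0)
  open import Algebra.Properties.Semiring.Sum +-*-semiring public
    using (sum; sum-syntax; sum-cong-≗; ∑-comm; ∑-distrib-+; *-distribˡ-sum; *-distribʳ-sum)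
  open import Data.List using (filter; length; tabulate)
  open import Relation.Nullary.Decidable using (dec-false)
  open ≡-Reasoning

  𝟙 : Bool → ℕ
  𝟙 true = 1
  𝟙 false = 0

  count : ∀ {n} → (Fin n → Bool) → ℕ
  count c = sum (λ k → 𝟙 (c k))

  count-cong : ∀ {n} {c d : Fin n → Bool} → (∀ k → c k ≡ d k) → count c ≡ count d
  count-cong c≗d = sum-cong-≗ (cong 𝟙 ∘ c≗d)

  count-all : ∀ n → count {n} (λ _ → true) ≡ n
  count-all zero = refl
  count-all (suc n) = cong suc (count-all n)

  count-none : ∀ n → count {n} (λ _ → false) ≡ 0
  count-none zero = refl
  count-none (suc n) = count-none n

  count-zero : ∀ {n} (c : Fin n → Bool) → count c ≡ 0 → ∀ k → c k ≡ false
  count-zero c c≡0 zero with c zero | m+n≡0⇒m≡0 (𝟙 (c zero)) c≡0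
  ... | false | _ = refl
  count-zero c c≡0 (suc k) = count-zero (c ∘ suc) (m+n≡0⇒n≡0 (𝟙 (c zero)) c≡0) k

  count-guard : ∀ {n} a (c : Fin n → Bool) → count (λ k → a ∧ c k) ≡ 𝟙 a * count c
  count-guard true c = sym (+-identityʳ (count c))
  count-guard {n} false c = count-none n

  length-filter : ∀ {A : Set} {P : A → Set} (P? : ∀ a → Dec (P a)) {n} (f : Fin n → A) →
                  length (filter P? (tabulate f)) ≡ count (λ j → does (P? (f j)))
  length-filter P? {zero} f = refl
  length-filter P? {suc n} f with does (P? (f zero))
  ... | true = cong suc (length-filter P? (f ∘ suc))
  ... | false = length-filter P? (f ∘ suc)

  away : ∀ {n} → Fin n → (Fin n → Bool) → Fin n → Bool
  away x c z = not (does (z ≟ x)) ∧ c z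

  away-≢ : ∀ {n} {x z : Fin n} {c : Fin n → Bool} → T (away x c z) → z ≢ x
  away-≢ {x = x} {z} h with z ≟ x
  ... | no z≢x = z≢x

  count-split : ∀ {n} (c : Fin n → Bool) (x : Fin n) → count c ≡ 𝟙 (c x) + count (away x c)
  count-split c zero = refl
  count-split c (suc x) = begin
    c₀ + count (c ∘ suc)          ≡⟨ cong (c₀ +_) (count-split (c ∘ suc) x) ⟩
    c₀ + (cₓ + rest)              ≡⟨ +-assoc c₀ cₓ rest ⟨
    (c₀ + cₓ) + rest              ≡⟨ cong (_+ rest) (+-comm c₀ cₓ) ⟩
    (cₓ + c₀) + rest              ≡⟨ +-assoc cₓ c₀ rest ⟩
    cₓ + (c₀ + rest) ∎
    where
    c₀ = 𝟙 (c zero)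
    cₓ = 𝟙 (c (suc x))
    rest = count (away x (c ∘ suc))

  count-away : ∀ {n} (c : Fin n → Bool) {x} → T (c x) → suc (count (away x c)) ≡ count c
  count-away c {x} cx with c x | count-split c x
  ... | true | split = sym split

  count-away₂ : ∀ {n} (c : Fin n → Bool) {x y} → x ≢ y → T (c x) → T (c y) →
                2 + count (away y (away x c)) ≡ count c
  count-away₂ c {x} {y} x≢y cx cy = trans (cong suc (count-away (away x c) cy′)) (count-away c cx)
    where
    cy′ : T (away x c y)
    cy′ rewrite dec-false (y ≟ x) (x≢y ∘ sym) = cy

  𝟙-guard : ∀ a {x y} → (T a → x ≡ y) → 𝟙 a * x ≡ 𝟙 a * y
  𝟙-guard true x≡y = cong (1 *_) (x≡y _)
  𝟙-guard false _ = refl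

  double-count : ∀ {m n} (P : Fin m → Bool) (Q : Fin n → Bool) (I : Fin m → Fin n → Bool) {c d : ℕ} →
                 (∀ z → T (P z) → count (λ j → Q j ∧ I z j) ≡ c) →
                 (∀ j → T (Q j) → count (λ z → P z ∧ I z j) ≡ d) →
                 count P * c ≡ count Q * d
  double-count {m} {n} P Q I {c} {d} per-point per-block = begin
    count P * c
      ≡⟨ *-distribʳ-sum c (λ z → 𝟙 (P z)) ⟩
    ∑[ z < m ] (𝟙 (P z) * c)
      ≡⟨ sum-cong-≗ (λ z → 𝟙-guard (P z) (sym ∘ per-point z)) ⟩
    ∑[ z < m ] (𝟙 (P z) * count (λ j → Q j ∧ I z j))
      ≡⟨ sum-cong-≗ (λ z → *-distribˡ-sum (𝟙 (P z)) (λ j → 𝟙 (Q j ∧ I z j))) ⟩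
    ∑[ z < m ] ∑[ j < n ] (𝟙 (P z) * 𝟙 (Q j ∧ I z j))
      ≡⟨ ∑-comm (λ z j → 𝟙 (P z) * 𝟙 (Q j ∧ I z j)) ⟩
    ∑[ j < n ] ∑[ z < m ] (𝟙 (P z) * 𝟙 (Q j ∧ I z j))
      ≡⟨ sum-cong-≗ (λ j → sum-cong-≗ (λ z → exchange (P z) (Q j) (I z j))) ⟩
    ∑[ j < n ] ∑[ z < m ] (𝟙 (Q j) * 𝟙 (P z ∧ I z j))
      ≡⟨ sum-cong-≗ (λ j → *-distribˡ-sum (𝟙 (Q j)) (λ z → 𝟙 (P z ∧ I z j))) ⟨
    ∑[ j < n ] (𝟙 (Q j) * count (λ z → P z ∧ I z j))
      ≡⟨ sum-cong-≗ (λ j → 𝟙-guard (Q j) (per-block j)) ⟩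
    ∑[ j < n ] (𝟙 (Q j) * d)
      ≡⟨ *-distribʳ-sum d (λ j → 𝟙 (Q j)) ⟨
    count Q * d ∎
    where
    exchange : ∀ p q i → 𝟙 p * 𝟙 (q ∧ i) ≡ 𝟙 q * 𝟙 (p ∧ i)
    exchange true true i = refl
    exchange true false i = refl
    exchange false true i = refl
    exchange false false i = refl

module Membership where

  open import Data.Fin.Subset using (∣_∣)
  open import Data.Fin.Subset.Properties using (_∈?_)
  open import Data.Vec using ([]; _∷_; lookup)
  open import Data.Vec.Properties using ([]=⇒lookup; lookup⇒[]=)
  open import Data.Bool.Properties using (T-≡)
  open import Data.Empty using (⊥-elim)
  open import Function using (_⇔_; mk⇔; Equivalence)
  open Equivalence using (to; from)
  open Counting using (count)

  _∈ᵇ_ : ∀ {n} → Fin n → Subset n → Bool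
  x ∈ᵇ S = lookup S x

  ∈⇔∈ᵇ : ∀ {n} {x : Fin n} {S : Subset n} → x ∈ S ⇔ T (x ∈ᵇ S)
  ∈⇔∈ᵇ {x = x} {S} = mk⇔ (from T-≡ ∘ []=⇒lookup) (lookup⇒[]= x S ∘ to T-≡)

  ∈?-∈ᵇ : ∀ {n} (x : Fin n) (S : Subset n) → does (x ∈? S) ≡ x ∈ᵇ S
  ∈?-∈ᵇ zero (true ∷ S) = refl
  ∈?-∈ᵇ zero (false ∷ S) = refl
  ∈?-∈ᵇ (suc x) (_ ∷ S) = ∈?-∈ᵇ x S

  ∣∣-count : ∀ {n} (S : Subset n) → ∣ S ∣ ≡ count (_∈ᵇ S)
  ∣∣-count [] = refl
  ∣∣-count (true ∷ S) = cong suc (∣∣-count S)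
  ∣∣-count (false ∷ S) = ∣∣-count S

  does-sound : ∀ {P : Set} (d : Dec P) → T (does d) → P
  does-sound (yes p) _ = p

  does-complete : ∀ {P : Set} (d : Dec P) → P → T (does d)
  does-complete (yes _) _ = _
  does-complete (no ¬p) p = ¬p p

  T-⇔→≡ : ∀ {a c : Bool} → T a ⇔ T c → a ≡ c
  T-⇔→≡ {true} {true} _ = refl
  T-⇔→≡ {true} {false} h = ⊥-elim (to h _)
  T-⇔→≡ {false} {true} h = ⊥-elim (from h _)
  T-⇔→≡ {false} {false} _ = refl

module Enumerations where

  open import Data.Nat using (zero; suc)
  open import Data.Fin.Subset using (_∈_; ∣_∣)
  open import Data.Fin.Subset.Properties using (_∈?_)
  open import Data.List using (List; length; lookup; filter; allFin)
  open import Data.List.Membership.Propositional.Properties using (∈-lookup; ∈-filter⁺; ∈-filter⁻; ∈-allFin)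
  open import Data.List.Relation.Unary.All as All using ()
  open import Data.List.Relation.Unary.AllPairs using (_∷_)
  open import Data.List.Relation.Unary.Any using (index)
  open import Data.List.Relation.Unary.Any.Properties using (lookup-index)
  open import Data.List.Relation.Unary.Unique.Propositional using (Unique)
  open import Data.List.Relation.Unary.Unique.Propositional.Properties using (filter⁺; allFin⁺)
  open import Data.Product using (∃; _,_; proj₂)
  open import Data.Empty using (⊥-elim)
  open Counting using (count-cong; length-filter)
  open Membership using (∈?-∈ᵇ; ∣∣-count)

  record Enumeration {A : Set} (P : A → Set) (n : ℕ) : Set where
    field
      point     : Fin n → A
      injective : ∀ {k l} → point k ≡ point l → k ≡ l
      sound     : ∀ k → P (point k)
      complete  : ∀ {x} → P x → ∃ λ k → x ≡ point k

  lookup-injective : ∀ {A : Set} {xs : List A} → Unique xs → ∀ {k l} → lookup xs k ≡ lookup xs l → k ≡ l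
  lookup-injective (_ ∷ _) {zero} {zero} _ = refl
  lookup-injective (x∉ ∷ _) {zero} {suc l} x≡ = ⊥-elim (All.lookup x∉ (∈-lookup l) x≡)
  lookup-injective (x∉ ∷ _) {suc k} {zero} ≡x = ⊥-elim (All.lookup x∉ (∈-lookup k) (sym ≡x))
  lookup-injective (_ ∷ u) {suc k} {suc l} eq = cong suc (lookup-injective u eq)

  enumerate : ∀ {v} (S : Subset v) → Enumeration (_∈ S) ∣ S ∣
  enumerate {v} S = subst (Enumeration (_∈ S)) length-members (record
    { point     = lookup members
    ; injective = lookup-injective (filter⁺ (_∈? S) (allFin⁺ v))
    ; sound     = λ k → proj₂ (∈-filter⁻ (_∈? S) {xs = allFin v} (∈-lookup k))
    ; complete  = λ x∈S → let p = ∈-filter⁺ (_∈? S) (∈-allFin _) x∈S in index p , lookup-index p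
    })
    where
    members = filter (_∈? S) (allFin v)
    length-members : length members ≡ ∣ S ∣
    length-members = trans (length-filter (_∈? S) (λ x → x))
                           (trans (count-cong (λ x → ∈?-∈ᵇ x S)) (sym (∣∣-count S)))

module Designs {v b : ℕ} (𝓑 : Fin b → Subset v) where

  open import Data.Nat using (zero; suc; _+_; _*_; _∸_; _/_)
  open import Data.Nat.Properties using (*-identityʳ; *-assoc; *-distribʳ-+; *-cancelʳ-≡)
  open import Data.Nat.DivMod using (m*n/n≡m)
  open import Data.Nat.Combinatorics using (_C_; nC1≡n; nCk+nC[k+1]≡[n+1]C[k+1])
  open import Data.Nat.Solver using (module +-*-Solver)
  open import Data.Fin.Subset using (_⊆_; _∈_; ∣_∣)
  open import Data.Fin.Subset.Properties using (_⊆?_)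
  open import Data.List using (filter; length; allFin)
  open import Data.Vec using () renaming (tabulate to tabulateᵛ)
  open import Data.Vec.Properties using (lookup∘tabulate)
  open import Data.Bool.Properties using (T-∧; T-∨; ∧-assoc)
  open import Data.Product using (_,_; proj₂)
  open import Data.Sum using (inj₁; inj₂)
  open import Function using (_∘_; _⇔_; mk⇔; Equivalence)
  open import Relation.Nullary.Decidable using (dec-true; dec-false)
  open import Defs using (IsSQS; r₁; r₂)
  open Counting
  open Membership
  open Equivalence using (to; from)
  open ≡-Reasoning

  2-subsets·2 : ∀ n → (suc n C 2) * 2 ≡ suc n * n
  2-subsets·2 zero = refl
  2-subsets·2 (suc n) = begin
    (suc (suc n) C 2) * 2                ≡⟨ cong (_* 2) (nCk+nC[k+1]≡[n+1]C[k+1] (suc n) 1) ⟨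
    (suc n C 1 + suc n C 2) * 2        ≡⟨ cong (λ m → (m + suc n C 2) * 2) (nC1≡n (suc n)) ⟩
    (suc n + suc n C 2) * 2            ≡⟨ *-distribʳ-+ 2 (suc n) (suc n C 2) ⟩
    suc n * 2 + (suc n C 2) * 2          ≡⟨ cong (suc n * 2 +_) (2-subsets·2 n) ⟩
    suc n * 2 + suc n * n
      ≡⟨ solve 1 (λ m → (con 1 :+ m) :* con 2 :+ (con 1 :+ m) :* m := (con 2 :+ m) :* (con 1 :+ m)) refl n ⟩
    suc (suc n) * suc n ∎
    where open +-*-Solver

  through₁ : Fin v → ℕ
  through₁ x = count (λ j → x ∈ᵇ 𝓑 j)

  through₂ : Fin v → Fin v → ℕ
  through₂ x y = count (λ j → x ∈ᵇ 𝓑 j ∧ y ∈ᵇ 𝓑 j)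

  through₃ : Fin v → Fin v → Fin v → ℕ
  through₃ x y z = count (λ j → (x ∈ᵇ 𝓑 j ∧ y ∈ᵇ 𝓑 j) ∧ z ∈ᵇ 𝓑 j)

  triple : Fin v → Fin v → Fin v → Subset v
  triple x y z = tabulateᵛ (λ w → does (w ≟ x) ∨ does (w ≟ y) ∨ does (w ≟ z))

  module _ {x y z : Fin v} (x≢y : x ≢ y) (x≢z : x ≢ z) (y≢z : y ≢ z) where

    private
      is-xyz : Fin v → Bool
      is-xyz w = does (w ≟ x) ∨ does (w ≟ y) ∨ does (w ≟ z)

      ∈-triple : ∀ {w} → w ∈ triple x y z ⇔ T (is-xyz w)
      ∈-triple {w} = subst (λ c → w ∈ triple x y z ⇔ T c) (lookup∘tabulate is-xyz w) ∈⇔∈ᵇ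

      x∈ : T (is-xyz x)
      x∈ rewrite dec-true (x ≟ x) refl = _

      y∈ : T (is-xyz y)
      y∈ rewrite dec-false (y ≟ x) (x≢y ∘ sym) | dec-true (y ≟ y) refl = _

      z∈ : T (is-xyz z)
      z∈ rewrite dec-false (z ≟ x) (x≢z ∘ sym) | dec-false (z ≟ y) (y≢z ∘ sym) | dec-true (z ≟ z) refl = _

      z-left : T (away y (away x is-xyz) z)
      z-left rewrite dec-false (z ≟ y) (y≢z ∘ sym) | dec-false (z ≟ x) (x≢z ∘ sym) | dec-true (z ≟ z) refl = _

      nothing-else : ∀ w → away z (away y (away x is-xyz)) w ≡ false
      nothing-else w = exhaust (does (w ≟ x)) (does (w ≟ y)) (does (w ≟ z))
        where
        exhaust : ∀ a c d → not d ∧ (not c ∧ (not a ∧ (a ∨ c ∨ d))) ≡ false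
        exhaust a c true = refl
        exhaust a true false = refl
        exhaust true false false = refl
        exhaust false false false = refl

    -- Three distinct points form a 3-set: removing x, y and z in turn leaves nothing.
    ∣triple∣≡3 : ∣ triple x y z ∣ ≡ 3
    ∣triple∣≡3 = begin
      ∣ triple x y z ∣                             ≡⟨ ∣∣-count (triple x y z) ⟩
      count (_∈ᵇ triple x y z)                      ≡⟨ count-cong (lookup∘tabulate is-xyz) ⟩
      count is-xyz                                  ≡⟨ count-away₂ is-xyz x≢y x∈ y∈ ⟨
      2 + count (away y (away x is-xyz))            ≡⟨ cong (2 +_) (count-away (away y (away x is-xyz)) z-left) ⟨
      3 + count (away z (away y (away x is-xyz)))   ≡⟨ cong (3 +_) (trans (count-cong nothing-else) (count-none v)) ⟩
      3 ∎

    triple-⊆ : ∀ S → does (triple x y z ⊆? S) ≡ (x ∈ᵇ S ∧ y ∈ᵇ S) ∧ z ∈ᵇ S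
    triple-⊆ S = T-⇔→≡ (mk⇔ (contains ∘ does-sound (triple x y z ⊆? S))
                             (does-complete (triple x y z ⊆? S) ∘ contained))
      where
      contains : triple x y z ⊆ S → T ((x ∈ᵇ S ∧ y ∈ᵇ S) ∧ z ∈ᵇ S)
      contains sub = from (T-∧ {x ∈ᵇ S ∧ y ∈ᵇ S}) (from (T-∧ {x ∈ᵇ S}) (at x∈ , at y∈) , at z∈)
        where at : ∀ {w} → T (is-xyz w) → T (w ∈ᵇ S)
              at = to ∈⇔∈ᵇ ∘ sub ∘ from ∈-triple
      contained : T ((x ∈ᵇ S ∧ y ∈ᵇ S) ∧ z ∈ᵇ S) → triple x y z ⊆ S
      contained h {w} w∈ with to (T-∧ {x ∈ᵇ S ∧ y ∈ᵇ S}) h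
      ... | xy∈S , z∈S with to (T-∧ {x ∈ᵇ S}) xy∈S
      ...   | x∈S , y∈S = from ∈⇔∈ᵇ (one-of (to ∈-triple w∈))
        where
        equal-to : ∀ {u} → T (u ∈ᵇ S) → T (does (w ≟ u)) → T (w ∈ᵇ S)
        equal-to {u} u∈S w≡u = subst (λ u → T (u ∈ᵇ S)) (sym (does-sound (w ≟ u) w≡u)) u∈S
        one-of : T (is-xyz w) → T (w ∈ᵇ S)
        one-of h′ with to T-∨ h′
        ... | inj₁ w≡x = equal-to x∈S w≡x
        ... | inj₂ h″ with to T-∨ h″
        ...   | inj₁ w≡y = equal-to y∈S w≡y
        ...   | inj₂ w≡z = equal-to z∈S w≡z

  module Regularity (sqs : IsSQS v b 𝓑) where

    open IsSQS sqs

    through₃≡1 : ∀ {x y z} → x ≢ y → x ≢ z → y ≢ z → through₃ x y z ≡ 1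
    through₃≡1 {x} {y} {z} x≢y x≢z y≢z = begin
      through₃ x y z
        ≡⟨ count-cong (sym ∘ triple-⊆ x≢y x≢z y≢z ∘ 𝓑) ⟩
      count (λ j → does (triple x y z ⊆? 𝓑 j))
        ≡⟨ length-filter (λ j → triple x y z ⊆? 𝓑 j) (λ j → j) ⟨
      length (filter (λ j → triple x y z ⊆? 𝓑 j) (allFin b))
        ≡⟨ threeSets (triple x y z) (∣triple∣≡3 x≢y x≢z y≢z) ⟩
      1 ∎

    block-size : ∀ j → count (_∈ᵇ 𝓑 j) ≡ 4
    block-size j = trans (sym (∣∣-count (𝓑 j))) (blockSize j)

    -- Double counting the pairs (z, block) with z ∉ {x, y} and x, y, z in the block:
    -- each such z lies in one block with x and y, and each block through x, y has 2 other points.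
    v≡2+2·through₂ : ∀ {x y} → x ≢ y → 2 + through₂ x y * 2 ≡ v
    v≡2+2·through₂ {x} {y} x≢y = begin
      2 + through₂ x y * 2 ≡⟨ cong (2 +_) (double-count outside Q (λ z j → z ∈ᵇ 𝓑 j) per-point per-block) ⟨
      2 + count outside * 1 ≡⟨ cong (2 +_) (*-identityʳ (count outside)) ⟩
      2 + count outside     ≡⟨ count-away₂ (λ _ → true) x≢y _ _ ⟩
      count {v} (λ _ → true) ≡⟨ count-all v ⟩
      v ∎
      where
      outside : Fin v → Bool
      outside = away y (away x (λ _ → true))
      Q : Fin b → Bool
      Q j = x ∈ᵇ 𝓑 j ∧ y ∈ᵇ 𝓑 j
      per-point : ∀ z → T (outside z) → count (λ j → Q j ∧ z ∈ᵇ 𝓑 j) ≡ 1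
      per-point z z∉ = through₃≡1 x≢y (z≢x ∘ sym) (z≢y ∘ sym)
        where
        z≢y = away-≢ {c = away x (λ _ → true)} z∉
        z≢x = away-≢ {c = λ _ → true} (proj₂ (to (T-∧ {not (does (z ≟ y))}) z∉))
      per-block : ∀ j → T (Q j) → count (λ z → outside z ∧ z ∈ᵇ 𝓑 j) ≡ 2
      per-block j xy∈ with to (T-∧ {x ∈ᵇ 𝓑 j}) xy∈
      ... | x∈ , y∈ = begin
        count (λ z → outside z ∧ z ∈ᵇ 𝓑 j)
          ≡⟨ count-cong (λ z → trans (∧-assoc (not (does (z ≟ y))) _ (z ∈ᵇ 𝓑 j))
                                     (cong (not (does (z ≟ y)) ∧_) (∧-assoc (not (does (z ≟ x))) true (z ∈ᵇ 𝓑 j)))) ⟩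
        count (away y (away x (_∈ᵇ 𝓑 j)))
          ≡⟨ cong (_∸ 2) (trans (count-away₂ (_∈ᵇ 𝓑 j) x≢y x∈ y∈) (block-size j)) ⟩
        2 ∎

    through₂≡r₂ : ∀ {x y} → x ≢ y → through₂ x y ≡ r₂ v
    through₂≡r₂ {x} {y} x≢y = sym (begin
      ((v ∸ 2) C 1) / 2           ≡⟨ cong (_/ 2) (nC1≡n (v ∸ 2)) ⟩
      (v ∸ 2) / 2                 ≡⟨ cong (λ n → (n ∸ 2) / 2) (v≡2+2·through₂ x≢y) ⟨
      (through₂ x y * 2) / 2      ≡⟨ m*n/n≡m (through₂ x y) 2 ⟩
      through₂ x y ∎)

    -- Double counting the pairs (y, block) with y ≠ x and x, y in the block:
    -- each such y lies in r₂ v blocks with x, and each block through x has 3 other points.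
    through₁-count : ∀ x → (v ∸ 1) * r₂ v ≡ through₁ x * 3
    through₁-count x = begin
      (v ∸ 1) * r₂ v
        ≡⟨ cong (λ n → (n ∸ 1) * r₂ v) (trans (count-away (λ _ → true) {x} _) (count-all v)) ⟨
      count others * r₂ v
        ≡⟨ double-count others (λ j → x ∈ᵇ 𝓑 j) (λ y j → y ∈ᵇ 𝓑 j) per-point per-block ⟩
      through₁ x * 3 ∎
      where
      others : Fin v → Bool
      others = away x (λ _ → true)
      per-point : ∀ y → T (others y) → through₂ x y ≡ r₂ v
      per-point y y≠x = through₂≡r₂ (away-≢ y≠x ∘ sym)
      per-block : ∀ j → T (x ∈ᵇ 𝓑 j) → count (λ y → others y ∧ y ∈ᵇ 𝓑 j) ≡ 3
      per-block j x∈ = trans (count-cong (λ y → ∧-assoc (not (does (y ≟ x))) true (y ∈ᵇ 𝓑 j)))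
                             (cong (_∸ 1) (trans (count-away (_∈ᵇ 𝓑 j) x∈) (block-size j)))

    through₁≡r₁ : ∀ {x y} → x ≢ y → through₁ x ≡ r₁ v
    through₁≡r₁ {x} {y} x≢y = sym (begin
      ((v ∸ 1) C 2) / 3                 ≡⟨ cong (λ n → ((n ∸ 1) C 2) / 3) (v≡2+2·through₂ x≢y) ⟨
      (suc k C 2) / 3                   ≡⟨ cong (_/ 3) (*-cancelʳ-≡ (suc k C 2) (through₁ x * 3) 2 C·2≡) ⟩
      (through₁ x * 3) / 3              ≡⟨ m*n/n≡m (through₁ x) 3 ⟩
      through₁ x ∎)
      where
      k = through₂ x y * 2
      C·2≡ : (suc k C 2) * 2 ≡ through₁ x * 3 * 2
      C·2≡ = begin
        (suc k C 2) * 2                   ≡⟨ 2-subsets·2 k ⟩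
        suc k * k                       ≡⟨ cong (λ n → suc k * (n * 2)) (through₂≡r₂ x≢y) ⟩
        suc k * (r₂ v * 2)              ≡⟨ *-assoc (suc k) (r₂ v) 2 ⟨
        suc k * r₂ v * 2                ≡⟨ cong (λ n → (n ∸ 1) * r₂ v * 2) (v≡2+2·through₂ x≢y) ⟩
        (v ∸ 1) * r₂ v * 2              ≡⟨ cong (_* 2) (through₁-count x) ⟩
        through₁ x * 3 * 2 ∎

module SecondOrder where

  open import Data.Nat using (zero; suc; _+_; _*_)
  open import Data.Nat.Properties using (+-identityʳ; *-distribʳ-+)
  open import Data.Bool.Properties using (∧-zeroʳ)
  open import Data.Nat.Combinatorics using (_C_; nC1≡n; nCk+nC[k+1]≡[n+1]C[k+1])
  open import Data.Fin.Properties using (suc-injective)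
  open import Function using (_∘_)
  open Counting
  open ≡-Reasoning

  anyᶠ : ∀ {n} → (Fin n → Bool) → Bool
  anyᶠ {zero} c = false
  anyᶠ {suc n} c = c zero ∨ anyᶠ (c ∘ suc)

  guard-anyᶠ : ∀ {n} a (t c : Fin n → Bool) → a ∧ anyᶠ (λ k → t k ∧ c k) ≡ anyᶠ (λ k → t k ∧ (a ∧ c k))
  guard-anyᶠ true t c = refl
  guard-anyᶠ false t c = sym (none t)
    where
    none : ∀ {n} (t : Fin n → Bool) → anyᶠ (λ k → t k ∧ false) ≡ false
    none {zero} t = refl
    none {suc n} t = cong₂ _∨_ (∧-zeroʳ (t zero)) (none (t ∘ suc))

  pairs : ∀ {n} → (Fin n → Bool) → ℕ
  pairs {zero} c = 0
  pairs {suc n} c = 𝟙 (c zero) * count (c ∘ suc) + pairs (c ∘ suc)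

  -- Pascal's rule, C(s+1, 2) = s + C(s, 2), at each step.
  pairs≡C2 : ∀ {n} (c : Fin n → Bool) → pairs c ≡ count c C 2
  pairs≡C2 {zero} c = refl
  pairs≡C2 {suc n} c with c zero
  ... | false = pairs≡C2 (c ∘ suc)
  ... | true = begin
    1 * count (c ∘ suc) + pairs (c ∘ suc)   ≡⟨ cong₂ _+_ (+-identityʳ (count (c ∘ suc))) (pairs≡C2 (c ∘ suc)) ⟩
    count (c ∘ suc) + count (c ∘ suc) C 2   ≡⟨ cong (_+ count (c ∘ suc) C 2) (nC1≡n (count (c ∘ suc))) ⟨
    count (c ∘ suc) C 1 + count (c ∘ suc) C 2 ≡⟨ nCk+nC[k+1]≡[n+1]C[k+1] (count (c ∘ suc)) 1 ⟩
    suc (count (c ∘ suc)) C 2 ∎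

  PairFree : ∀ {n} → (Fin n → Bool) → Set
  PairFree c = ∀ {k l} → k ≢ l → c k ∧ c l ≡ false

  TripleFree : ∀ {n} → (Fin n → Bool) → Set
  TripleFree c = ∀ {k l m} → k ≢ l → k ≢ m → l ≢ m → c k ∧ c l ∧ c m ≡ false

  pairs-pairFree : ∀ {n} (c : Fin n → Bool) → PairFree c → pairs c ≡ 0
  pairs-pairFree {zero} c _ = refl
  pairs-pairFree {suc n} c pf with c zero in c₀
  ... | false = pairs-pairFree (c ∘ suc) (pf ∘ (_∘ suc-injective))
  ... | true = cong₂ _+_ (trans (+-identityʳ _) (trans (count-cong rest-false) (count-none n)))
                         (pairs-pairFree (c ∘ suc) (pf ∘ (_∘ suc-injective)))
    where
    rest-false : ∀ k → c (suc k) ≡ false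
    rest-false k = subst (λ b → b ∧ c (suc k) ≡ false) c₀ (pf {zero} {suc k} λ ())

  -- Bonferroni at second order is exact for triple-free families: if the first event occurs,
  -- triple-freeness leaves no pair among the others.
  any+pairs≡count : ∀ {n} (c : Fin n → Bool) → TripleFree c → 𝟙 (anyᶠ c) + pairs c ≡ count c
  any+pairs≡count {zero} c _ = refl
  any+pairs≡count {suc n} c tf with c zero in c₀
  ... | false = any+pairs≡count (c ∘ suc) λ k≢l k≢m l≢m →
                  tf (k≢l ∘ suc-injective) (k≢m ∘ suc-injective) (l≢m ∘ suc-injective)
  ... | true = cong suc (trans (cong₂ _+_ (+-identityʳ _) (pairs-pairFree (c ∘ suc) rest-pairFree)) (+-identityʳ _))
    where
    rest-pairFree : PairFree (c ∘ suc)
    rest-pairFree {k} {l} k≢l =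
      subst (λ b → b ∧ c (suc k) ∧ c (suc l) ≡ false) c₀ (tf (λ ()) (λ ()) (k≢l ∘ suc-injective))

  pairs-sum : ∀ {n b} (s : Fin b → Fin n → Bool) {a₂} →
              (∀ {k l} → k ≢ l → count (λ j → s j k ∧ s j l) ≡ a₂) →
              ∀ t → ∑[ j < b ] pairs (λ k → t k ∧ s j k) ≡ pairs t * a₂
  pairs-sum {zero} {b} s deg₂ t = count-none b
  pairs-sum {suc n} {b} s {a₂} deg₂ t = begin
    ∑[ j < b ] (𝟙 (head j) * count (tail j) + pairs (tail j))
      ≡⟨ ∑-distrib-+ (λ j → 𝟙 (head j) * count (tail j)) (λ j → pairs (tail j)) ⟩
    ∑[ j < b ] (𝟙 (head j) * count (tail j)) + ∑[ j < b ] pairs (tail j)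
      ≡⟨ cong₂ _+_ pairs-with-0 (pairs-sum (λ j → s j ∘ suc) (deg₂ ∘ (_∘ suc-injective)) (t ∘ suc)) ⟩
    𝟙 (t zero) * count (t ∘ suc) * a₂ + pairs (t ∘ suc) * a₂
      ≡⟨ *-distribʳ-+ a₂ (𝟙 (t zero) * count (t ∘ suc)) (pairs (t ∘ suc)) ⟨
    pairs t * a₂ ∎
    where
    head : Fin b → Bool
    head j = t zero ∧ s j zero
    tail : Fin b → Fin n → Bool
    tail j l = t (suc l) ∧ s j (suc l)

    regroup : ∀ a x c y → 𝟙 (a ∧ x) * 𝟙 (c ∧ y) ≡ 𝟙 (a ∧ c) * 𝟙 (x ∧ y)
    regroup false x c y = refl
    regroup true false false y = refl
    regroup true true false y = refl
    regroup true false true y = refl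
    regroup true true true y = refl

    pairs-with-0 : ∑[ j < b ] (𝟙 (head j) * count (tail j)) ≡ 𝟙 (t zero) * count (t ∘ suc) * a₂
    pairs-with-0 = begin
      ∑[ j < b ] (𝟙 (head j) * count (tail j))
        ≡⟨ sum-cong-≗ (λ j → *-distribˡ-sum (𝟙 (head j)) (λ l → 𝟙 (tail j l))) ⟩
      ∑[ j < b ] ∑[ l < n ] (𝟙 (head j) * 𝟙 (tail j l))
        ≡⟨ ∑-comm (λ j l → 𝟙 (head j) * 𝟙 (tail j l)) ⟩
      ∑[ l < n ] ∑[ j < b ] (𝟙 (head j) * 𝟙 (tail j l))
        ≡⟨ sum-cong-≗ (λ l → sum-cong-≗ (λ j → regroup (t zero) (s j zero) (t (suc l)) (s j (suc l)))) ⟩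
      ∑[ l < n ] ∑[ j < b ] (𝟙 (t zero ∧ t (suc l)) * 𝟙 (s j zero ∧ s j (suc l)))
        ≡⟨ sum-cong-≗ (λ l → *-distribˡ-sum (𝟙 (t zero ∧ t (suc l))) (λ j → 𝟙 (s j zero ∧ s j (suc l)))) ⟨
      ∑[ l < n ] (𝟙 (t zero ∧ t (suc l)) * count (λ j → s j zero ∧ s j (suc l)))
        ≡⟨ sum-cong-≗ (λ l → cong (𝟙 (t zero ∧ t (suc l)) *_) (deg₂ λ ())) ⟩
      ∑[ l < n ] (𝟙 (t zero ∧ t (suc l)) * a₂)
        ≡⟨ *-distribʳ-sum a₂ (λ l → 𝟙 (t zero ∧ t (suc l))) ⟨
      count (λ l → t zero ∧ t (suc l)) * a₂
        ≡⟨ cong (_* a₂) (count-guard (t zero) (t ∘ suc)) ⟩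
      𝟙 (t zero) * count (t ∘ suc) * a₂ ∎

  restrict-tripleFree : ∀ {n} (t c : Fin n → Bool) → TripleFree c → TripleFree (λ k → t k ∧ c k)
  restrict-tripleFree t c tf {k} {l} {m} k≢l k≢m l≢m = restrict (t k) (t l) (t m) (tf k≢l k≢m l≢m)
    where
    restrict : ∀ a b d {x y z} → x ∧ y ∧ z ≡ false → (a ∧ x) ∧ (b ∧ y) ∧ (d ∧ z) ≡ false
    restrict false _ _ _ = refl
    restrict true false _ {x} _ = ∧-zeroʳ x
    restrict true true false {x} {y} _ = trans (cong (x ∧_) (∧-zeroʳ y)) (∧-zeroʳ x)
    restrict true true true h = h

  hits-formula : ∀ {n b} (s : Fin b → Fin n → Bool) {a₁ a₂} →
                 (∀ k → count (λ j → s j k) ≡ a₁) →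
                 (∀ {k l} → k ≢ l → count (λ j → s j k ∧ s j l) ≡ a₂) →
                 (∀ j → TripleFree (s j)) →
                 ∀ t → count (λ j → anyᶠ (λ k → t k ∧ s j k)) + (count t C 2) * a₂ ≡ count t * a₁
  hits-formula {n} {b} s {a₁} {a₂} deg₁ deg₂ tf t = begin
    hits + (count t C 2) * a₂
      ≡⟨ cong (λ p → hits + p * a₂) (pairs≡C2 t) ⟨
    hits + pairs t * a₂
      ≡⟨ cong (hits +_) (pairs-sum s deg₂ t) ⟨
    hits + ∑[ j < b ] pairs (meet j)
      ≡⟨ ∑-distrib-+ (λ j → 𝟙 (anyᶠ (meet j))) (λ j → pairs (meet j)) ⟨
    ∑[ j < b ] (𝟙 (anyᶠ (meet j)) + pairs (meet j))
      ≡⟨ sum-cong-≗ (λ j → any+pairs≡count (meet j) (restrict-tripleFree t (s j) (tf j))) ⟩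
    ∑[ j < b ] count (meet j)
      ≡⟨ ∑-comm (λ j k → 𝟙 (meet j k)) ⟩
    ∑[ k < n ] count (λ j → t k ∧ s j k)
      ≡⟨ sum-cong-≗ (λ k → trans (count-guard (t k) (λ j → s j k)) (cong (𝟙 (t k) *_) (deg₁ k))) ⟩
    ∑[ k < n ] (𝟙 (t k) * a₁)
      ≡⟨ *-distribʳ-sum a₁ (λ k → 𝟙 (t k)) ⟨
    count t * a₁ ∎
    where
    meet : Fin b → Fin n → Bool
    meet j k = t k ∧ s j k
    hits : ℕ
    hits = count (λ j → anyᶠ (meet j))

module SubsetSums where

  open import Data.Nat using (zero; suc)
  open import Data.Fin.Subset using (inside; outside; ∣_∣)
  open import Data.Vec using ([]; _∷_)
  open import Data.List using (List; []; _∷_; map; _++_)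
  open import Data.List.Properties using (map-++; map-∘)
  open import Data.List.Membership.Propositional as List using ()
  open import Data.List.Membership.Propositional.Properties using (∈-map⁺; ∈-++⁺ˡ; ∈-++⁺ʳ)
  open import Data.List.Relation.Unary.Any using (here)
  open import Data.Rational using (ℚ; 0ℚ; 1ℚ; _+_; _*_; -_; _-_; _/_)
  open import Data.Rational.Properties
    using (+-identityˡ; +-identityʳ; +-assoc; *-identityˡ; *-distribˡ-+; neg-distrib-+; neg-distribˡ-*)
  open import Data.Rational.Solver using (module +-*-Solver)
  open import Data.Integer using (+_)
  open import Defs using (allSubsets; sumℚ)
  open ≡-Reasoning

  Σ𝒫 : ∀ {m} → (Subset m → ℚ) → ℚ
  Σ𝒫 {zero} f = f []
  Σ𝒫 {suc m} f = Σ𝒫 (λ T → f (outside ∷ T)) + Σ𝒫 (λ T → f (inside ∷ T))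

  Σ𝒫-cong : ∀ {m} {f g : Subset m → ℚ} → (∀ T → f T ≡ g T) → Σ𝒫 f ≡ Σ𝒫 g
  Σ𝒫-cong {zero} f≗g = f≗g []
  Σ𝒫-cong {suc m} f≗g = cong₂ _+_ (Σ𝒫-cong (f≗g ∘ (outside ∷_))) (Σ𝒫-cong (f≗g ∘ (inside ∷_)))

  Σ𝒫-+ : ∀ {m} (f g : Subset m → ℚ) → Σ𝒫 (λ T → f T + g T) ≡ Σ𝒫 f + Σ𝒫 g
  Σ𝒫-+ {zero} f g = refl
  Σ𝒫-+ {suc m} f g = begin
    Σ𝒫 (λ T → f (outside ∷ T) + g (outside ∷ T)) + Σ𝒫 (λ T → f (inside ∷ T) + g (inside ∷ T))
      ≡⟨ cong₂ _+_ (Σ𝒫-+ (f ∘ (outside ∷_)) (g ∘ (outside ∷_)))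
                   (Σ𝒫-+ (f ∘ (inside ∷_)) (g ∘ (inside ∷_))) ⟩
    (F₀ + G₀) + (F₁ + G₁)
      ≡⟨ solve 4 (λ a b c d → (a :+ b) :+ (c :+ d) := (a :+ c) :+ (b :+ d)) refl F₀ G₀ F₁ G₁ ⟩
    (F₀ + F₁) + (G₀ + G₁) ∎
    where
    open +-*-Solver
    F₀ = Σ𝒫 (f ∘ (outside ∷_)); F₁ = Σ𝒫 (f ∘ (inside ∷_))
    G₀ = Σ𝒫 (g ∘ (outside ∷_)); G₁ = Σ𝒫 (g ∘ (inside ∷_))

  Σ𝒫-scale : ∀ {m} (k : ℚ) (f : Subset m → ℚ) → Σ𝒫 (λ T → k * f T) ≡ k * Σ𝒫 f
  Σ𝒫-scale {zero} k f = refl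
  Σ𝒫-scale {suc m} k f = trans (cong₂ _+_ (Σ𝒫-scale k (f ∘ (outside ∷_))) (Σ𝒫-scale k (f ∘ (inside ∷_))))
                                (sym (*-distribˡ-+ k (Σ𝒫 (f ∘ (outside ∷_))) (Σ𝒫 (f ∘ (inside ∷_)))))

  Σ𝒫-neg : ∀ {m} (f : Subset m → ℚ) → Σ𝒫 (λ T → - f T) ≡ - Σ𝒫 f
  Σ𝒫-neg {zero} f = refl
  Σ𝒫-neg {suc m} f = trans (cong₂ _+_ (Σ𝒫-neg (f ∘ (outside ∷_))) (Σ𝒫-neg (f ∘ (inside ∷_))))
                           (sym (neg-distrib-+ (Σ𝒫 (f ∘ (outside ∷_))) (Σ𝒫 (f ∘ (inside ∷_)))))

  Σ𝒫-vanish : ∀ {m} (f : Subset m → ℚ) → (∀ T → f T ≡ 0ℚ) → Σ𝒫 f ≡ 0ℚ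
  Σ𝒫-vanish {zero} f f≡0 = f≡0 []
  Σ𝒫-vanish {suc m} f f≡0 = trans (cong₂ _+_ (Σ𝒫-vanish (f ∘ (outside ∷_)) (f≡0 ∘ (outside ∷_)))
                                               (Σ𝒫-vanish (f ∘ (inside ∷_)) (f≡0 ∘ (inside ∷_))))
                                   (+-identityʳ 0ℚ)

  Σ𝒫-allSubsets : ∀ {m} (f : Subset m → ℚ) → sumℚ (map f (allSubsets m)) ≡ Σ𝒫 f
  Σ𝒫-allSubsets {zero} f = +-identityʳ (f [])
  Σ𝒫-allSubsets {suc m} f = begin
    sumℚ (map f (map (outside ∷_) L ++ map (inside ∷_) L))
      ≡⟨ cong sumℚ (map-++ f (map (outside ∷_) L) (map (inside ∷_) L)) ⟩
    sumℚ (map f (map (outside ∷_) L) ++ map f (map (inside ∷_) L))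
      ≡⟨ sumℚ-++ (map f (map (outside ∷_) L)) _ ⟩
    sumℚ (map f (map (outside ∷_) L)) + sumℚ (map f (map (inside ∷_) L))
      ≡⟨ cong₂ _+_ (cong sumℚ (map-∘ L)) (cong sumℚ (map-∘ L)) ⟨
    sumℚ (map (f ∘ (outside ∷_)) L) + sumℚ (map (f ∘ (inside ∷_)) L)
      ≡⟨ cong₂ _+_ (Σ𝒫-allSubsets (f ∘ (outside ∷_))) (Σ𝒫-allSubsets (f ∘ (inside ∷_))) ⟩
    Σ𝒫 f ∎
    where
    L = allSubsets m
    sumℚ-++ : ∀ xs ys → sumℚ (xs ++ ys) ≡ sumℚ xs + sumℚ ys
    sumℚ-++ [] ys = sym (+-identityˡ (sumℚ ys))
    sumℚ-++ (x ∷ xs) ys = trans (cong (_+_ x) (sumℚ-++ xs ys)) (sym (+-assoc x (sumℚ xs) (sumℚ ys)))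

  allSubsets-complete : ∀ {m} (A : Subset m) → A List.∈ allSubsets m
  allSubsets-complete [] = here refl
  allSubsets-complete {suc m} (false ∷ A) = ∈-++⁺ˡ (∈-map⁺ (outside ∷_) (allSubsets-complete A))
  allSubsets-complete {suc m} (true ∷ A) =
    ∈-++⁺ʳ (map (outside ∷_) (allSubsets m)) (∈-map⁺ (inside ∷_) (allSubsets-complete A))

  sgn : ∀ {m} → Subset m → ℚ
  sgn [] = 1ℚ
  sgn (a ∷ T) = if a then - sgn T else sgn T

  Δ : ℕ → (ℕ → ℚ) → ℕ → ℚ
  Δ zero f k = f k
  Δ (suc m) f k = Δ m f k - Δ m f (suc k)

  Δ-shift : ∀ m (f : ℕ → ℚ) k → Δ m (λ s → f (suc s)) k ≡ Δ m f (suc k)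
  Δ-shift zero f k = refl
  Δ-shift (suc m) f k = cong₂ _-_ (Δ-shift m f k) (Δ-shift m f (suc k))

  -- Grouping subsets by size: the signed sum of f over the subsets of an m-set is Δᵐ f 0.
  signed-sum : ∀ m (f : ℕ → ℚ) → Σ𝒫 {m} (λ T → sgn T * f ∣ T ∣) ≡ Δ m f 0
  signed-sum zero f = *-identityˡ (f 0)
  signed-sum (suc m) f = begin
    Σ𝒫 {m} (λ T → sgn T * f ∣ T ∣) + Σ𝒫 {m} (λ T → - sgn T * f (suc ∣ T ∣))
      ≡⟨ cong (_+_ (Σ𝒫 {m} (λ T → sgn T * f ∣ T ∣))) odd-sets ⟩
    Σ𝒫 {m} (λ T → sgn T * f ∣ T ∣) - Σ𝒫 {m} (λ T → sgn T * f (suc ∣ T ∣))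
      ≡⟨ cong₂ _-_ (signed-sum m f) (trans (signed-sum m (λ s → f (suc s))) (Δ-shift m f 0)) ⟩
    Δ m f 0 - Δ m f 1 ∎
    where
    -- Adding the new point flips the sign and raises the size by one.
    odd-sets : Σ𝒫 {m} (λ T → - sgn T * f (suc ∣ T ∣)) ≡ - Σ𝒫 {m} (λ T → sgn T * f (suc ∣ T ∣))
    odd-sets = trans (Σ𝒫-cong {m} (λ T → sym (neg-distribˡ-* (sgn T) (f (suc ∣ T ∣)))))
                     (Σ𝒫-neg {m} (λ T → sgn T * f (suc ∣ T ∣)))

  signed-sum₄ : (f : ℕ → ℚ) → Σ𝒫 {4} (λ T → sgn T * f ∣ T ∣) ≡
                (((f 0 - (+ 4 / 1) * f 1) + (+ 6 / 1) * f 2) - (+ 4 / 1) * f 3) + f 4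
  signed-sum₄ f = trans (signed-sum 4 f)
    (solve 5 (λ a b c d e →
        (((a :- b) :- (b :- c)) :- ((b :- c) :- (c :- d))) :- (((b :- c) :- (c :- d)) :- ((c :- d) :- (d :- e)))
      := (((a :- con (+ 4 / 1) :* b) :+ con (+ 6 / 1) :* c) :- con (+ 4 / 1) :* d) :+ e)
      refl (f 0) (f 1) (f 2) (f 3) (f 4))
    where open +-*-Solver

module Products where

  open import Data.Nat using (_+_)
  open import Data.Rational using (ℚ; 0ℚ; _*_)
  open import Data.Rational.Properties using (*-zeroˡ; *-zeroʳ; *-identityˡ; *-assoc; *-1-monoid)
  open import Algebra.Properties.Monoid.Sum *-1-monoid public using () renaming (sum to ∏; sum-cong-≗ to ∏-cong)
  open import Defs using (_^_)
  open Counting using (sum)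

  ∏-zero : ∀ {n} (f : Fin n → ℚ) k → f k ≡ 0ℚ → ∏ f ≡ 0ℚ
  ∏-zero f zero fk≡0 = trans (cong (_* ∏ (f ∘ suc)) fk≡0) (*-zeroˡ (∏ (f ∘ suc)))
  ∏-zero f (suc k) fk≡0 = trans (cong (f zero *_) (∏-zero (f ∘ suc) k fk≡0)) (*-zeroʳ (f zero))

  ^-+ : ∀ (x : ℚ) m n → x ^ (m + n) ≡ x ^ m * x ^ n
  ^-+ x zero n = sym (*-identityˡ (x ^ n))
  ^-+ x (suc m) n = trans (cong (x *_) (^-+ x m n)) (sym (*-assoc x (x ^ m) (x ^ n)))

  ∏-^ : ∀ {n} (x : ℚ) (e : Fin n → ℕ) → ∏ (λ j → x ^ e j) ≡ x ^ sum e
  ∏-^ {zero} x e = refl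
  ∏-^ {suc n} x e = trans (cong (x ^ e zero *_) (∏-^ x (e ∘ suc))) (sym (^-+ x (e zero) (sum (e ∘ suc))))

module Coverage where

  open import Data.Fin.Subset using (_∪_; ⊤; ⊥)
  open import Data.Fin.Subset.Properties using (_⊆?_; x∈p∪q⁺; x∈p∪q⁻)
  open import Data.Vec using ([]; _∷_; here; there) renaming (tabulate to tabulateᵛ)
  open import Data.Product using (∃; _×_; _,_)
  open import Data.Sum using (_⊎_; inj₁; inj₂)
  open import Data.Rational using (ℚ; 0ℚ; 1ℚ; _+_; _*_; -_; _-_)
  open import Data.Rational.Properties using (*-identityˡ; *-identityʳ; *-zeroˡ; +-identityʳ; +-inverseʳ; neg-distribʳ-*)
  open import Data.Rational.Solver using (module +-*-Solver)
  open import Data.Bool.Properties using (∨-zeroʳ; ∧-zeroʳ)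
  open Membership using (_∈ᵇ_)
  open SecondOrder using (anyᶠ)
  open SubsetSums
  open Products using (∏)
  open ≡-Reasoning

  χ : Bool → ℚ
  χ true = 1ℚ
  χ false = 0ℚ

  if-χ : ∀ c (x : ℚ) → (if c then x else 0ℚ) ≡ χ c * x
  if-χ true x = sym (*-identityˡ x)
  if-χ false x = sym (*-zeroˡ x)

  meets : ∀ {m} → Subset m → Subset m → Bool
  meets [] [] = false
  meets (a ∷ T) (u ∷ U) = (a ∧ u) ∨ meets T U

  meets-∪ : ∀ {m} (T U V : Subset m) → meets T (U ∪ V) ≡ meets T U ∨ meets T V
  meets-∪ [] [] [] = refl
  meets-∪ (false ∷ T) (u ∷ U) (w ∷ V) = meets-∪ T U V
  meets-∪ (true ∷ T) (true ∷ U) (w ∷ V) = refl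
  meets-∪ (true ∷ T) (false ∷ U) (true ∷ V) = sym (∨-zeroʳ (meets T U))
  meets-∪ (true ∷ T) (false ∷ U) (false ∷ V) = meets-∪ T U V

  meets-⊥ : ∀ {m} (T : Subset m) → meets T ⊥ ≡ false
  meets-⊥ [] = refl
  meets-⊥ (false ∷ T) = meets-⊥ T
  meets-⊥ (true ∷ T) = meets-⊥ T

  meets-tabulate : ∀ {m} (T : Subset m) (u : Fin m → Bool) → meets T (tabulateᵛ u) ≡ anyᶠ (λ k → k ∈ᵇ T ∧ u k)
  meets-tabulate [] u = refl
  meets-tabulate (a ∷ T) u = cong ((a ∧ u zero) ∨_) (meets-tabulate T (u ∘ suc))

  reach : ∀ {m n} → Subset m → (Fin n → Subset m) → Subset n → Subset m
  reach U t [] = U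
  reach U t (a ∷ A) = reach (if a then U ∪ t zero else U) (t ∘ suc) A

  ∈-reach⁺ : ∀ {m n} {k : Fin m} (U : Subset m) (t : Fin n → Subset m) (A : Subset n) →
             k ∈ U ⊎ (∃ λ j → j ∈ A × k ∈ t j) → k ∈ reach U t A
  ∈-reach⁺ U t [] (inj₁ k∈U) = k∈U
  ∈-reach⁺ U t (true ∷ A) (inj₁ k∈U) = ∈-reach⁺ (U ∪ t zero) (t ∘ suc) A (inj₁ (x∈p∪q⁺ (inj₁ k∈U)))
  ∈-reach⁺ U t (false ∷ A) (inj₁ k∈U) = ∈-reach⁺ U (t ∘ suc) A (inj₁ k∈U)
  ∈-reach⁺ U t (true ∷ A) (inj₂ (zero , here , k∈t)) =
    ∈-reach⁺ (U ∪ t zero) (t ∘ suc) A (inj₁ (x∈p∪q⁺ (inj₂ k∈t)))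
  ∈-reach⁺ U t (true ∷ A) (inj₂ (suc j , there j∈A , k∈t)) =
    ∈-reach⁺ (U ∪ t zero) (t ∘ suc) A (inj₂ (j , j∈A , k∈t))
  ∈-reach⁺ U t (false ∷ A) (inj₂ (suc j , there j∈A , k∈t)) = ∈-reach⁺ U (t ∘ suc) A (inj₂ (j , j∈A , k∈t))

  ∈-reach⁻ : ∀ {m n} {k : Fin m} (U : Subset m) (t : Fin n → Subset m) (A : Subset n) →
             k ∈ reach U t A → k ∈ U ⊎ (∃ λ j → j ∈ A × k ∈ t j)
  ∈-reach⁻ U t [] k∈ = inj₁ k∈
  ∈-reach⁻ U t (false ∷ A) k∈ with ∈-reach⁻ U (t ∘ suc) A k∈
  ... | inj₁ k∈U = inj₁ k∈U
  ... | inj₂ (j , j∈A , k∈t) = inj₂ (suc j , there j∈A , k∈t)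
  ∈-reach⁻ U t (true ∷ A) k∈ with ∈-reach⁻ (U ∪ t zero) (t ∘ suc) A k∈
  ... | inj₂ (j , j∈A , k∈t) = inj₂ (suc j , there j∈A , k∈t)
  ... | inj₁ k∈U∪u with x∈p∪q⁻ U (t zero) k∈U∪u
  ...   | inj₁ k∈U = inj₁ k∈U
  ...   | inj₂ k∈u = inj₂ (zero , here , k∈u)

  weight : ∀ {n} → (Fin n → ℚ) → Subset n → ℚ
  weight ρ A = ∏ (λ j → if j ∈ᵇ A then ρ j else 1ℚ - ρ j)

  missProb : ∀ {m n} → (Fin n → ℚ) → (Fin n → Subset m) → Subset m → ℚ
  missProb ρ t T = ∏ (λ j → if meets T (t j) then 1ℚ - ρ j else 1ℚ)

  term : ∀ {m} → Subset m → Subset m → Subset m → ℚ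
  term B U T = χ (does (T ⊆? B) ∧ not (meets T U)) * sgn T

  signed-count : ∀ {m} (B U : Subset m) → Σ𝒫 (term B U) ≡ χ (does (B ⊆? U))
  signed-count [] [] = *-identityʳ 1ℚ
  signed-count {suc m} (false ∷ B) (u ∷ U) =
    trans (cong₂ _+_ (signed-count B U) (Σ𝒫-vanish {m} _ (λ T → *-zeroˡ (- sgn T)))) (+-identityʳ _)
  signed-count {suc m} (true ∷ B) (true ∷ U) =
    trans (cong₂ _+_ (signed-count B U) (Σ𝒫-vanish {m} _ λ T →
            trans (cong (λ c → χ c * - sgn T) (∧-zeroʳ (does (T ⊆? B)))) (*-zeroˡ (- sgn T))))
          (+-identityʳ _)
  signed-count {suc m} (true ∷ B) (false ∷ U) = begin
    Σ𝒫 (term B U) + Σ𝒫 {m} (λ T → χ (does (T ⊆? B) ∧ not (meets T U)) * - sgn T)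
      ≡⟨ cong (_+_ (Σ𝒫 (term B U))) (trans (Σ𝒫-cong {m} (λ T → negate T)) (Σ𝒫-neg (term B U))) ⟩
    Σ𝒫 (term B U) - Σ𝒫 (term B U)
      ≡⟨ +-inverseʳ (Σ𝒫 (term B U)) ⟩
    0ℚ ∎
    where
    negate : ∀ T → χ (does (T ⊆? B) ∧ not (meets T U)) * - sgn T ≡ - term B U T
    negate T = sym (neg-distribʳ-* (χ (does (T ⊆? B) ∧ not (meets T U))) (sgn T))

  ⊆?-⊤ : ∀ {m} (T : Subset m) → does (T ⊆? ⊤) ≡ true
  ⊆?-⊤ [] = refl
  ⊆?-⊤ (false ∷ T) = ⊆?-⊤ T
  ⊆?-⊤ (true ∷ T) = ⊆?-⊤ T

  term-⊤-⊥ : ∀ {m} (T : Subset m) → term ⊤ ⊥ T ≡ sgn T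
  term-⊤-⊥ T rewrite ⊆?-⊤ T | meets-⊥ T = *-identityˡ (sgn T)

  private
    -- When T is excluded (not inside B or already meeting U) both terms vanish.
    excluded : ∀ (r s M F : ℚ) → (1ℚ - r) * (0ℚ * s * M) + r * (0ℚ * s * M) ≡ 0ℚ * s * (F * M)
    excluded = solve 4 (λ r s M F → (con 1ℚ :- r) :* (con 0ℚ :* s :* M) :+ r :* (con 0ℚ :* s :* M)
                                    := con 0ℚ :* s :* (F :* M)) refl
      where open +-*-Solver

  -- Adding a player with trace u and availability r: averaging over its availability the
  -- signed terms for the covered sets U and U ∪ u multiplies the miss probability by its factor.
  add-player : ∀ c x y (r s M : ℚ) →
    (1ℚ - r) * (χ (c ∧ not x) * s * M) + r * (χ (c ∧ not (x ∨ y)) * s * M)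
      ≡ χ (c ∧ not x) * s * ((if y then 1ℚ - r else 1ℚ) * M)
  add-player false x y r s M = excluded r s M (if y then 1ℚ - r else 1ℚ)
  add-player true true y r s M = excluded r s M (if y then 1ℚ - r else 1ℚ)
  add-player true false true r s M =
    solve 3 (λ r s M → (con 1ℚ :- r) :* (con 1ℚ :* s :* M) :+ r :* (con 0ℚ :* s :* M)
                       := con 1ℚ :* s :* ((con 1ℚ :- r) :* M)) refl r s M
    where open +-*-Solver
  add-player true false false r s M =
    solve 3 (λ r s M → (con 1ℚ :- r) :* (con 1ℚ :* s :* M) :+ r :* (con 1ℚ :* s :* M)
                       := con 1ℚ :* s :* (con 1ℚ :* M)) refl r s M
    where open +-*-Solver

  coverage : ∀ {m n} (B U : Subset m) (ρ : Fin n → ℚ) (t : Fin n → Subset m) →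
             Σ𝒫 (λ A → χ (does (B ⊆? reach U t A)) * weight ρ A) ≡ Σ𝒫 (λ T → term B U T * missProb ρ t T)
  coverage {n = zero} B U ρ t = begin
    χ (does (B ⊆? U)) * 1ℚ        ≡⟨ *-identityʳ _ ⟩
    χ (does (B ⊆? U))             ≡⟨ signed-count B U ⟨
    Σ𝒫 (term B U)                ≡⟨ Σ𝒫-cong (λ T → sym (*-identityʳ (term B U T))) ⟩
    Σ𝒫 (λ T → term B U T * 1ℚ) ∎
  coverage {m} {suc n} B U ρ t = begin
    Σ𝒫 (λ A → χ (covered U A) * ((1ℚ - r) * W A)) + Σ𝒫 (λ A → χ (covered (U ∪ u) A) * (r * W A))
      ≡⟨ cong₂ _+_ (pull (1ℚ - r) U) (pull r (U ∪ u)) ⟩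
    (1ℚ - r) * Σ𝒫 (λ A → χ (covered U A) * W A) + r * Σ𝒫 (λ A → χ (covered (U ∪ u) A) * W A)
      ≡⟨ cong₂ (λ x y → (1ℚ - r) * x + r * y) (coverage B U (ρ ∘ suc) (t ∘ suc))
                                              (coverage B (U ∪ u) (ρ ∘ suc) (t ∘ suc)) ⟩
    (1ℚ - r) * Σ𝒫 (λ T → term B U T * M T) + r * Σ𝒫 (λ T → term B (U ∪ u) T * M T)
      ≡⟨ cong₂ _+_ (Σ𝒫-scale (1ℚ - r) (λ T → term B U T * M T))
                   (Σ𝒫-scale r (λ T → term B (U ∪ u) T * M T)) ⟨
    Σ𝒫 (λ T → (1ℚ - r) * (term B U T * M T)) + Σ𝒫 (λ T → r * (term B (U ∪ u) T * M T))
      ≡⟨ Σ𝒫-+ (λ T → (1ℚ - r) * (term B U T * M T)) (λ T → r * (term B (U ∪ u) T * M T)) ⟨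
    Σ𝒫 (λ T → (1ℚ - r) * (term B U T * M T) + r * (term B (U ∪ u) T * M T))
      ≡⟨ Σ𝒫-cong step ⟩
    Σ𝒫 (λ T → term B U T * missProb ρ t T) ∎
    where
    r = ρ zero
    u = t zero
    W = weight (ρ ∘ suc)
    M = missProb (ρ ∘ suc) (t ∘ suc)
    covered : Subset m → Subset n → Bool
    covered V A = does (B ⊆? reach V (t ∘ suc) A)
    step : ∀ T → (1ℚ - r) * (term B U T * M T) + r * (term B (U ∪ u) T * M T) ≡ term B U T * missProb ρ t T
    step T rewrite meets-∪ T U u = add-player (does (T ⊆? B)) (meets T U) (meets T u) r (sgn T) (M T)
    pull : ∀ k V → Σ𝒫 (λ A → χ (covered V A) * (k * W A)) ≡ k * Σ𝒫 (λ A → χ (covered V A) * W A)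
    pull k V = trans (Σ𝒫-cong (λ A → solve 3 (λ c k w → c :* (k :* w) := k :* (c :* w)) refl (χ (covered V A)) k (W A)))
                     (Σ𝒫-scale k (λ A → χ (covered V A) * W A))
      where open +-*-Solver

module RepairEvent {v b n : ℕ} (𝓑 : Fin b → Subset v) (i : Fin b)
                   (pts : Enumerations.Enumeration (_∈ 𝓑 i) n) where

  open import Data.Nat using (zero; suc)
  open import Data.Fin.Subset using (_⊆_; ⊤; ⊥; ⋃)
  open import Data.Fin.Subset.Properties using (_⊆?_; _∈?_; x∈p∪q⁺; x∈p∪q⁻; ∉⊥; ∈⊤)
  open import Data.Vec using () renaming (tabulate to tabulateᵛ)
  open import Data.Vec.Properties using (lookup∘tabulate)
  open import Data.List using (List; []; _∷_; map; allFin; tabulate)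
  open import Data.List.Membership.Propositional as List using (lose)
  open import Data.List.Membership.Propositional.Properties using (∈-filter⁺; ∈-filter⁻; ∈-allFin)
  open import Data.List.Relation.Unary.Any using (Any; here; there; satisfied)
  open import Data.List.Relation.Unary.Any.Properties using (any⇔)
  open import Data.Product using (∃; _×_; _,_; proj₂)
  open import Data.Sum using (inj₁; inj₂)
  open import Data.Empty using (⊥-elim)
  open import Relation.Nullary.Decidable using (_×-dec_; ¬?; dec-true)
  open import Data.Rational using (ℚ; 0ℚ; 1ℚ; _*_; _-_)
  open import Data.Rational.Properties using (*-zeroʳ)
  open import Function using (_⇔_; mk⇔; Equivalence)
  open import Function.Properties.Equivalence using () renaming (trans to ⇔-trans; sym to ⇔-sym)
  open import Defs using (unionOf; members; availableRepairExists; allSubsets; configWeight; repairProb; prodℚ)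
  open Equivalence using (to; from)
  open Enumerations.Enumeration pts
  open Membership
  open SubsetSums using (Σ𝒫; Σ𝒫-cong; Σ𝒫-allSubsets; allSubsets-complete)
  open Coverage
  open Products using (∏; ∏-cong; ∏-zero)
  open ≡-Reasoning

  trace : Fin b → Subset n
  trace j = tabulateᵛ (λ k → point k ∈ᵇ 𝓑 j)

  ∈-trace : ∀ {j k} → k ∈ trace j ⇔ point k ∈ 𝓑 j
  ∈-trace {j} {k} =
    ⇔-trans (subst (λ c → k ∈ trace j ⇔ T c) (lookup∘tabulate (λ k → point k ∈ᵇ 𝓑 j) k) ∈⇔∈ᵇ) (⇔-sym ∈⇔∈ᵇ)

  ∈-⋃⁻ : ∀ {x} (js : List (Fin b)) → x ∈ ⋃ (map 𝓑 js) → ∃ λ j → j List.∈ js × x ∈ 𝓑 j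
  ∈-⋃⁻ [] x∈ = ⊥-elim (∉⊥ x∈)
  ∈-⋃⁻ (j ∷ js) x∈ with x∈p∪q⁻ (𝓑 j) (⋃ (map 𝓑 js)) x∈
  ... | inj₁ x∈j = j , here refl , x∈j
  ... | inj₂ x∈js with ∈-⋃⁻ js x∈js
  ...   | j′ , j′∈ , x∈j′ = j′ , there j′∈ , x∈j′

  ∈-⋃⁺ : ∀ {x j} (js : List (Fin b)) → j List.∈ js → x ∈ 𝓑 j → x ∈ ⋃ (map 𝓑 js)
  ∈-⋃⁺ (j ∷ js) (here refl) x∈j = x∈p∪q⁺ (inj₁ x∈j)
  ∈-⋃⁺ (j ∷ js) (there j∈) x∈j = x∈p∪q⁺ (inj₂ (∈-⋃⁺ js j∈ x∈j))

  ∈-unionOf⁻ : ∀ {x} (S : Subset b) → x ∈ unionOf 𝓑 S → ∃ λ j → j ∈ S × x ∈ 𝓑 j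
  ∈-unionOf⁻ S x∈ with ∈-⋃⁻ (members S) x∈
  ... | j , j∈ , x∈j = j , proj₂ (∈-filter⁻ (_∈? S) {xs = allFin b} j∈) , x∈j

  ∈-unionOf⁺ : ∀ {x j} (S : Subset b) → j ∈ S → x ∈ 𝓑 j → x ∈ unionOf 𝓑 S
  ∈-unionOf⁺ {j = j} S j∈S = ∈-⋃⁺ (members S) (∈-filter⁺ (_∈? S) (∈-allFin j) j∈S)

  covers : Subset b → Bool
  covers A = does (⊤ ⊆? reach ⊥ trace A)

  -- There is an available repair set exactly when the available players' traces cover
  -- every point of 𝓑 i: a repair set inside A can always be enlarged to A itself.
  repair⇔covered : ∀ A → ¬ i ∈ A → availableRepairExists 𝓑 i A ≡ covers A
  repair⇔covered A i∉A =
    T-⇔→≡ (mk⇔ (covered ∘ satisfied ∘ from (any⇔ {xs = allSubsets b})) (to any⇔ ∘ A-repairs))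
    where
    repair? : (S : Subset b) → Dec (S ⊆ A × ¬ i ∈ S × 𝓑 i ⊆ unionOf 𝓑 S)
    repair? S = (S ⊆? A) ×-dec ((¬? (i ∈? S)) ×-dec (𝓑 i ⊆? unionOf 𝓑 S))

    covered : (∃ λ S → T (does (repair? S))) → T (does (⊤ ⊆? reach ⊥ trace A))
    covered (S , S-repairs) with does-sound (repair? S) S-repairs
    ... | S⊆A , _ , B⊆∪S =
      does-complete (⊤ ⊆? reach ⊥ trace A) λ {k} _ → reached k (∈-unionOf⁻ S (B⊆∪S (sound k)))
      where
      reached : ∀ k → (∃ λ j → j ∈ S × point k ∈ 𝓑 j) → k ∈ reach ⊥ trace A
      reached k (j , j∈S , k∈j) = ∈-reach⁺ ⊥ trace A (inj₂ (j , S⊆A j∈S , from ∈-trace k∈j))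

    A-repairs : T (does (⊤ ⊆? reach ⊥ trace A)) → Any (λ S → T (does (repair? S))) (allSubsets b)
    A-repairs A-covers = lose (allSubsets-complete A) (does-complete (repair? A) ((λ j∈A → j∈A) , i∉A , B⊆∪A))
      where
      B⊆∪A : 𝓑 i ⊆ unionOf 𝓑 A
      B⊆∪A x∈B with complete x∈B
      ... | k , refl with ∈-reach⁻ ⊥ trace A (does-sound (⊤ ⊆? reach ⊥ trace A) A-covers ∈⊤)
      ...   | inj₁ k∈⊥ = ⊥-elim (∉⊥ k∈⊥)
      ...   | inj₂ (j , j∈A , k∈j) = ∈-unionOf⁺ A j∈A (to ∈-trace k∈j)

  -- Player i is never available (it is the one to be repaired); the others are with probability p.
  availability : ℚ → Fin b → ℚ
  availability p j = if does (j ≟ i) then 0ℚ else p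

  prodℚ-tabulate : ∀ {A : Set} {m} (g : A → ℚ) (f : Fin m → A) → prodℚ (map g (tabulate f)) ≡ ∏ (g ∘ f)
  prodℚ-tabulate {m = zero} g f = refl
  prodℚ-tabulate {m = suc m} g f = cong (g (f zero) *_) (prodℚ-tabulate g (f ∘ suc))

  configWeight≡weight : ∀ p A → ¬ i ∈ A → configWeight p (1ℚ - p) i A ≡ weight (availability p) A
  configWeight≡weight p A i∉A = trans (prodℚ-tabulate {m = b} _ (λ j → j)) (∏-cong factor)
    where
    factor : ∀ j → (if does (j ≟ i) then 1ℚ else (if does (j ∈? A) then p else 1ℚ - p))
                   ≡ (if j ∈ᵇ A then availability p j else 1ℚ - availability p j)
    factor j with j ≟ i
    ... | no _ rewrite ∈?-∈ᵇ j A = refl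
    ... | yes refl with i ∈ᵇ A in i∈ᵇA
    ...   | false = refl
    ...   | true = ⊥-elim (i∉A (from ∈⇔∈ᵇ (subst T (sym i∈ᵇA) _)))

  weight-zero : ∀ p A → i ∈ A → weight (availability p) A ≡ 0ℚ
  weight-zero p A i∈A = ∏-zero _ i absent
    where
    absent : (if i ∈ᵇ A then availability p i else 1ℚ - availability p i) ≡ 0ℚ
    absent rewrite dec-true (i ≟ i) refl with i ∈ᵇ A | to ∈⇔∈ᵇ i∈A
    ... | true | _ = refl

  repairProb≡coverage : ∀ p → repairProb 𝓑 i p (1ℚ - p) ≡ Σ𝒫 (λ A → χ (covers A) * weight (availability p) A)
  repairProb≡coverage p = trans (Σ𝒫-allSubsets {b} _) (Σ𝒫-cong outcome)
    where
    outcome : ∀ A → (if does (i ∈? A) then 0ℚ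
                     else (if availableRepairExists 𝓑 i A then configWeight p (1ℚ - p) i A else 0ℚ))
                    ≡ χ (covers A) * weight (availability p) A
    outcome A with i ∈? A
    ... | yes i∈A = sym (trans (cong (χ (covers A) *_) (weight-zero p A i∈A)) (*-zeroʳ (χ (covers A))))
    ... | no i∉A = trans (cong₂ (λ c w → if c then w else 0ℚ) (repair⇔covered A i∉A) (configWeight≡weight p A i∉A))
                         (if-χ (covers A) (weight (availability p) A))

module BlockTraces {v b : ℕ} {𝓑 : Fin b → Subset v} (sqs : IsSQS v b 𝓑) (i : Fin b)
                   (pts : Enumerations.Enumeration (_∈ 𝓑 i) 4) where

  open import Data.Nat using (_+_; _*_; _∸_)
  open import Data.Nat.Properties using (m+n∸n≡m)
  open import Data.Nat.Combinatorics using (_C_)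
  open import Data.Fin.Subset using (∣_∣)
  open import Data.Bool.Properties using (T-∧; ∧-assoc)
  open import Data.Product using (_,_)
  open import Data.Rational using (1ℚ; _-_)
  open import Data.Rational.Properties using (*-identityʳ)
  open import Function using (Equivalence)
  open import Defs using (r₁; r₂; _^_)
  open Equivalence using (to; from)
  open Enumerations.Enumeration pts
  open Counting
  open Membership
  open SecondOrder
  open Designs 𝓑
  open Regularity sqs
  open Coverage using (missProb; meets; meets-tabulate)
  open Products using (∏-cong; ∏-^)
  open RepairEvent 𝓑 i pts using (trace; availability)
  open ≡-Reasoning

  incidence : Fin b → Fin 4 → Bool
  incidence j k = away i (λ j → point k ∈ᵇ 𝓑 j) j

  private
    in-block : ∀ k → T (point k ∈ᵇ 𝓑 i)
    in-block k = to ∈⇔∈ᵇ (sound k)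

    distinct : ∀ {k l} → k ≢ l → point k ≢ point l
    distinct k≢l = k≢l ∘ injective

    other : Fin 4 → Fin 4
    other zero = suc zero
    other (suc _) = zero

    other-≢ : ∀ k → k ≢ other k
    other-≢ zero ()
    other-≢ (suc k) ()

    both : ∀ g a c → (g ∧ a) ∧ (g ∧ c) ≡ g ∧ (a ∧ c)
    both true a c = refl
    both false a c = refl

    all-three : ∀ g a c d → (g ∧ a) ∧ (g ∧ c) ∧ (g ∧ d) ≡ g ∧ ((a ∧ c) ∧ d)
    all-three true a c d = sym (∧-assoc a c d)
    all-three false a c d = refl

  through-point : ∀ k → suc (count (λ j → incidence j k)) ≡ r₁ v
  through-point k = trans (count-away (λ j → point k ∈ᵇ 𝓑 j) (in-block k))
                          (through₁≡r₁ (distinct (other-≢ k)))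

  point-degree : ∀ k → count (λ j → incidence j k) ≡ r₁ v ∸ 1
  point-degree k = cong (_∸ 1) (through-point k)

  through-pair : ∀ {k l} → k ≢ l → suc (count (λ j → incidence j k ∧ incidence j l)) ≡ r₂ v
  through-pair {k} {l} k≢l = begin
    suc (count (λ j → incidence j k ∧ incidence j l))
      ≡⟨ cong suc (count-cong (λ j → both (not (does (j ≟ i))) (point k ∈ᵇ 𝓑 j) (point l ∈ᵇ 𝓑 j))) ⟩
    suc (count (away i (λ j → point k ∈ᵇ 𝓑 j ∧ point l ∈ᵇ 𝓑 j)))
      ≡⟨ count-away (λ j → point k ∈ᵇ 𝓑 j ∧ point l ∈ᵇ 𝓑 j)
                    (from (T-∧ {point k ∈ᵇ 𝓑 i}) (in-block k , in-block l)) ⟩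
    through₂ (point k) (point l)
      ≡⟨ through₂≡r₂ (distinct k≢l) ⟩
    r₂ v ∎

  pair-degree : ∀ {k l} → k ≢ l → count (λ j → incidence j k ∧ incidence j l) ≡ r₂ v ∸ 1
  pair-degree k≢l = cong (_∸ 1) (through-pair k≢l)

  triple-free : ∀ j → TripleFree (incidence j)
  triple-free j {k} {l} {m} k≢l k≢m l≢m = trans (all-three (not (does (j ≟ i))) _ _ _)
    (count-zero (away i (λ j → (point k ∈ᵇ 𝓑 j ∧ point l ∈ᵇ 𝓑 j) ∧ point m ∈ᵇ 𝓑 j)) none j)
    where
    in-i = from (T-∧ {point k ∈ᵇ 𝓑 i ∧ point l ∈ᵇ 𝓑 i})
                (from (T-∧ {point k ∈ᵇ 𝓑 i}) (in-block k , in-block l) , in-block m)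
    none = cong (_∸ 1) (trans (count-away (λ j → (point k ∈ᵇ 𝓑 j ∧ point l ∈ᵇ 𝓑 j) ∧ point m ∈ᵇ 𝓑 j) in-i)
                              (through₃≡1 (distinct k≢l) (distinct k≢m) (distinct l≢m)))

  hits : Subset 4 → ℕ
  hits T = count (λ j → anyᶠ (λ k → k ∈ᵇ T ∧ incidence j k))

  exponent : ℕ → ℕ
  exponent s = s * (r₁ v ∸ 1) ∸ (s C 2) * (r₂ v ∸ 1)

  hits-by-size : ∀ T → hits T ≡ exponent ∣ T ∣
  hits-by-size T = begin
    hits T
      ≡⟨ m+n∸n≡m (hits T) pairs-term ⟨
    hits T + pairs-term ∸ pairs-term
      ≡⟨ cong (_∸ pairs-term) (hits-formula incidence point-degree pair-degree triple-free (_∈ᵇ T)) ⟩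
    count (_∈ᵇ T) * (r₁ v ∸ 1) ∸ pairs-term
      ≡⟨ cong exponent (∣∣-count T) ⟨
    exponent ∣ T ∣ ∎
    where
    pairs-term = (count (_∈ᵇ T) C 2) * (r₂ v ∸ 1)

  -- Every player j ≠ i whose trace meets T must be unavailable (probability q); player i never is.
  miss-power : ∀ p T → missProb (availability p) trace T ≡ (1ℚ - p) ^ hits T
  miss-power p T = trans (∏-cong factor) (∏-^ (1ℚ - p) (λ j → 𝟙 (anyᶠ (λ k → k ∈ᵇ T ∧ incidence j k))))
    where
    factor : ∀ j → (if meets T (trace j) then 1ℚ - availability p j else 1ℚ)
                   ≡ (1ℚ - p) ^ 𝟙 (anyᶠ (λ k → k ∈ᵇ T ∧ incidence j k))
    factor j rewrite sym (guard-anyᶠ (not (does (j ≟ i))) (_∈ᵇ T) (λ k → point k ∈ᵇ 𝓑 j))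
                   | sym (meets-tabulate T (λ k → point k ∈ᵇ 𝓑 j)) with j ≟ i | meets T (trace j)
    ... | yes _ | true = refl
    ... | yes _ | false = refl
    ... | no _ | true = sym (*-identityʳ (1ℚ - p))
    ... | no _ | false = refl

  r₁≡suc : r₁ v ≡ suc (r₁ v ∸ 1)
  r₁≡suc = trans (sym (through-point zero)) (cong suc (point-degree zero))

  r₂≡suc : r₂ v ≡ suc (r₂ v ∸ 1)
  r₂≡suc = trans (sym (through-pair first≢second)) (cong suc (pair-degree first≢second))
    where
    first≢second : zero ≢ suc zero
    first≢second ()

module Exponents {R₁ R₂ a₁ a₂ : ℕ} (R₁≡ : R₁ ≡ suc a₁) (R₂≡ : R₂ ≡ suc a₂) where

  open import Data.Nat using (_+_; _*_; _∸_)
  open import Data.Nat.Properties using (+-identityʳ; [m+n]∸[m+o]≡n∸o)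
  open import Data.Nat.Combinatorics using (_C_)
  open import Data.Nat.Solver using (module +-*-Solver)
  open +-*-Solver

  private
    shifted : ∀ k {m n m′ n′} → k + m ≡ m′ → k + n ≡ n′ → m ∸ n ≡ m′ ∸ n′
    shifted k {m} {n} refl refl = sym ([m+n]∸[m+o]≡n∸o k m n)

  exponent₁ : 1 * a₁ ∸ (1 C 2) * a₂ ≡ R₁ ∸ 1
  exponent₁ rewrite R₁≡ = +-identityʳ a₁

  exponent₂ : 2 * a₁ ∸ (2 C 2) * a₂ ≡ 2 * R₁ ∸ (R₂ + 1)
  exponent₂ rewrite R₁≡ | R₂≡ =
    shifted 2 (solve 1 (λ a → con 2 :+ con 2 :* a := con 2 :* (con 1 :+ a)) refl a₁)
              (solve 1 (λ a → con 2 :+ con 1 :* a := (con 1 :+ a) :+ con 1) refl a₂)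

  exponent₃ : 3 * a₁ ∸ (3 C 2) * a₂ ≡ 3 * R₁ ∸ 3 * R₂
  exponent₃ rewrite R₁≡ | R₂≡ =
    shifted 3 (solve 1 (λ a → con 3 :+ con 3 :* a := con 3 :* (con 1 :+ a)) refl a₁)
              (solve 1 (λ a → con 3 :+ con 3 :* a := con 3 :* (con 1 :+ a)) refl a₂)

  exponent₄ : 4 * a₁ ∸ (4 C 2) * a₂ ≡ 4 * R₁ + 2 ∸ 6 * R₂
  exponent₄ rewrite R₁≡ | R₂≡ =
    shifted 6 (solve 1 (λ a → con 6 :+ con 4 :* a := con 4 :* (con 1 :+ a) :+ con 2) refl a₁)
              (solve 1 (λ a → con 6 :+ con 6 :* a := con 6 :* (con 1 :+ a)) refl a₂)

open import Data.Nat using (_∸_)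
import Data.Nat
open import Data.Integer using (+_)
open import Data.Rational using (ℚ; 1ℚ; 0ℚ; _+_; _-_; _*_; _/_; _≤_)
open import Data.Fin.Subset using (⊤; ⊥; ∣_∣)
open import Defs using (repairProb; r₁; r₂; _^_)
open Enumerations using (Enumeration; enumerate)
open SubsetSums using (Σ𝒫; Σ𝒫-cong; sgn; signed-sum₄)
open Coverage using (χ; weight; term; missProb; coverage; term-⊤-⊥)

closed-form : ℚ → ℕ → ℕ → ℕ → ℕ → ℚ
closed-form q e₁ e₂ e₃ e₄ =
  ((((1ℚ - ((+ 4 / 1) * (q ^ e₁))) + ((+ 6 / 1) * (q ^ e₂))) - ((+ 4 / 1) * (q ^ e₃))) + (q ^ e₄))

closed-form-cong : ∀ q {e₁ e₂ e₃ e₄ f₁ f₂ f₃ f₄} → e₁ ≡ f₁ → e₂ ≡ f₂ → e₃ ≡ f₃ → e₄ ≡ f₄ →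
                   closed-form q e₁ e₂ e₃ e₄ ≡ closed-form q f₁ f₂ f₃ f₄
closed-form-cong q refl refl refl refl = refl

theorem3p5 : (v b : ℕ) (𝓑 : Fin b → Subset v) → IsSQS v b 𝓑 → (i : Fin b) →
    (p : ℚ) → 0ℚ ≤ p → p ≤ 1ℚ →
    let q = 1ℚ - p
        R₁ = r₁ v
        R₂ = r₂ v
    in repairProb 𝓑 i p q ≡
         ((((1ℚ - ((+ 4 / 1) * (q ^ (R₁ ∸ 1))))
           + ((+ 6 / 1) * (q ^ ((2 Data.Nat.* R₁) ∸ (R₂ Data.Nat.+ 1)))))
           - ((+ 4 / 1) * (q ^ ((3 Data.Nat.* R₁) ∸ (3 Data.Nat.* R₂)))))
           + (q ^ (((4 Data.Nat.* R₁) Data.Nat.+ 2) ∸ (6 Data.Nat.* R₂))))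
theorem3p5 v b 𝓑 sqs i p _ _ = begin
  repairProb 𝓑 i p q                                          ≡⟨ repairProb≡coverage p ⟩
  Σ𝒫 (λ A → χ (covers A) * weight (availability p) A)         ≡⟨ coverage ⊤ ⊥ (availability p) trace ⟩
  Σ𝒫 {4} (λ T → term ⊤ ⊥ T * missProb (availability p) trace T) ≡⟨ Σ𝒫-cong signed-miss ⟩
  Σ𝒫 {4} (λ T → sgn T * q ^ exponent ∣ T ∣)                    ≡⟨ signed-sum₄ (λ s → q ^ exponent s) ⟩
  closed-form q (exponent 1) (exponent 2) (exponent 3) (exponent 4)
    ≡⟨ closed-form-cong q exponent₁ exponent₂ exponent₃ exponent₄ ⟩
  closed-form q (r₁ v ∸ 1) (2 Data.Nat.* r₁ v ∸ (r₂ v Data.Nat.+ 1)) (3 Data.Nat.* r₁ v ∸ 3 Data.Nat.* r₂ v)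
                (4 Data.Nat.* r₁ v Data.Nat.+ 2 ∸ 6 Data.Nat.* r₂ v) ∎
  where
  open ≡-Reasoning
  q = 1ℚ - p
  pts = subst (Enumeration (_∈ 𝓑 i)) (IsSQS.blockSize sqs i) (enumerate (𝓑 i))
  open RepairEvent 𝓑 i pts using (trace; covers; availability; repairProb≡coverage)
  open BlockTraces sqs i pts using (exponent; hits-by-size; miss-power; r₁≡suc; r₂≡suc)
  open Exponents r₁≡suc r₂≡suc
  signed-miss : ∀ T → term ⊤ ⊥ T * missProb (availability p) trace T ≡ sgn T * q ^ exponent ∣ T ∣
  signed-miss T = cong₂ _*_ (term-⊤-⊥ T) (trans (miss-power p T) (cong (q ^_) (hits-by-size T)))
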